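{- Let $P$ be a decreasing tableau and $m,m'\in\mathbb{Z}_{>0}$. Let $\Phi(P,m)=(P',(r_1,c_1),\alpha)$ and $\Phi(P',m')=(P'',(r_2,c_2),\alpha')$. If $m'<m$, then $c_1<c_2$.
   Context: Tableaux use English notation; cell $(i,j)$ is in row $i$, column $j$. A decreasing tableau is a filling of the diagram of a partition by positive integers strictly decreasing from left to right along rows and from top to bottom along columns. $P_{>r}$ denotes the tableau obtained by deleting the first $r$ rows of $P$ (rows renumbered from 1). A value $x$ is $P$-ejectable if $x$ occurs in the first row of $P$ and either $x-1$ does not occur in the first row, or $x-1$ occurs in the first row and $x-1$ is $P_{>1}$-ejectable (nothing is ejectable in the empty tableau). Insertion $\Phi(P,m)=(P',(r,c),\alpha)$: set $P':=P$, $N:=m$, $i:=1$. At iteration $i$, let $R$ be the set of entries of row $i$ of $P$ (empty if no such row), $n_1$ the largest element of $R$ with $n_1\le N$. (T1) If $n_1$ does not exist, append $N$ at the end of row $i$ of $P'$ and output $(P',\text{new cell},1)$. Otherwise replace $n_1$ in row $i$ of $P'$ by $N$, and: (D) if $n_1=N$ and $N-1\in R$, set $N:=N-1$, go to iteration $i+1$; (DR) else if $n_1<N$ and $n_1$ is not $P_{>i}$-ejectable, set $N:=n_1$, go to iteration $i+1$; otherwise let $n_2$ be the entry immediately right of $n_1$ in row $i$ of $P$ ($0$ if none) and $y$ the largest $P_{>i}$-ejectable value with $n_2<y<n_1$: (IR1) if $y$ exists, $N:=y$, go to iteration $i+1$; (IR2) if not and $n_2>0$, $N:=n_2$, go to iteration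 $i+1$; (T2) if not and $n_2=0$, output $(P',\text{the cell of } N \text{ in row } i,0)$. -}

module Defs where

open import Data.Nat using (ℕ; zero; suc; _∸_; _⊔_; _<_; _≤_; _≟_; _≤?_; _<?_; _+_)
open import Data.Bool using (Bool; true; false; not; _∧_; _∨_; if_then_else_)
open import Data.List using (List; []; _∷_; _++_; length; [_])
open import Data.List.Relation.Unary.All using (All)
open import Data.List.Relation.Unary.Linked using (Linked)
open import Data.Maybe using (Maybe; just; nothing; maybe)
open import Data.Product using (_×_; _,_; proj₁; proj₂)
open import Relation.Nullary.Decidable using (⌊_⌋)
open import Relation.Binary.PropositionalEquality using (_≢_)

-- A tableau is a list of rows (row 1 first, English notation); a row is
-- the list of its entries from left to right.
Row : Set
Row = List ℕ

Tableau : Set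
Tableau = List Row

data Above : Row → Row → Set where
  []  : ∀ {R} → Above R []
  _∷_ : ∀ {a b R S} → b < a → Above R S → Above (a ∷ R) (b ∷ S)

_>_ : ℕ → ℕ → Set
a > b = b < a

record IsDecreasingTableau (P : Tableau) : Set where
  field
    rowsNonempty : All (λ R → R ≢ []) P
    positive     : All (All (λ x → 0 < x)) P
    rowsDecr     : All (Linked _>_) P
    colsDecr     : Linked Above P

mem : ℕ → Row → Bool
mem x []      = false
mem x (y ∷ R) = ⌊ x ≟ y ⌋ ∨ mem x R

largestWith : (ℕ → Bool) → Row → Maybe ℕ
largestWith p []      = nothing
largestWith p (x ∷ R) with largestWith p R
... | acc = if p x then just (maybe (x ⊔_) x acc) else acc

ejectable : Tableau → ℕ → Bool
ejectable []        x = false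
ejectable (R ∷ rest) x = mem x R ∧ (not (mem (x ∸ 1) R) ∨ ejectable rest (x ∸ 1))

indexOf : ℕ → Row → ℕ
indexOf x []      = 0
indexOf x (y ∷ R) = if ⌊ x ≟ y ⌋ then 0 else suc (indexOf x R)

replaceAt : ℕ → ℕ → Row → Row
replaceAt k       v []      = []
replaceAt zero    v (y ∷ R) = v ∷ R
replaceAt (suc k) v (y ∷ R) = y ∷ replaceAt k v R

entryOr0 : ℕ → Row → ℕ
entryOr0 k       []      = 0
entryOr0 zero    (y ∷ R) = y
entryOr0 (suc k) (y ∷ R) = entryOr0 k R

-- Result of insertion: (P', (r , c), α), cells 1-indexed.
Result : Set
Result = Tableau × (ℕ × ℕ) × ℕ

resTab : Result → Tableau
resTab = proj₁

resRow : Result → ℕ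
resRow res = proj₁ (proj₁ (proj₂ res))

resCol : Result → ℕ
resCol res = proj₂ (proj₁ (proj₂ res))

resAlpha : Result → ℕ
resAlpha res = proj₂ (proj₂ res)

consRow : Row → Result → Result
consRow R' (Q , cell , a) = (R' ∷ Q , cell , a)

firstRow : Tableau → Row
firstRow []      = []
firstRow (S ∷ _) = S

-- final step after (D)/(DR) fail: y is the candidate from (IR1)
-- (largest P_{>i}-ejectable value strictly between n2 and n1), `go` continues
-- with iteration i+1, `stop` is the (T2) output.
irStep : Maybe ℕ → ℕ → (ℕ → Result) → Result → Result
irStep (just y) n2      go stop = go y        -- (IR1)
irStep nothing  zero    go stop = stop        -- (T2)
irStep nothing  (suc n) go stop = go (suc n)  -- (IR2)

-- ins i rows N : iteration i of the insertion, where rows = rows i, i+1, ...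
-- of the original tableau P (so the tail of rows is P_{>i}).
ins : ℕ → Tableau → ℕ → Result
ins i [] N = ([ N ] ∷ [] , (i , 1) , 1)                         -- (T1), row i absent
ins i (R ∷ rest) N with largestWith (λ x → ⌊ x ≤? N ⌋) R
... | nothing = ((R ++ [ N ]) ∷ rest , (i , suc (length R)) , 1)  -- (T1)
... | just n1 =
  let k  = indexOf n1 R
      R' = replaceAt k N R
      n2 = entryOr0 (suc k) R
      go = λ N' → consRow R' (ins (suc i) rest N')
      y  = largestWith (λ y → ⌊ n2 <? y ⌋ ∧ ⌊ y <? n1 ⌋ ∧ ejectable rest y) (firstRow rest)
  in if ⌊ n1 ≟ N ⌋ ∧ mem (N ∸ 1) R then go (N ∸ 1)                 -- (D)
     else if ⌊ n1 <? N ⌋ ∧ not (ejectable rest n1) then go n1       -- (DR)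
     else irStep y n2 go (R' ∷ rest , (i , suc k) , 0)

Φ : Tableau → ℕ → Result
Φ P m = ins 1 P m

module Submission where

-- In a decreasing row R a value N enters at column 1 + count≥ (suc N) R, where count≥ v R is the
-- number of entries of R that are at least v. When the insertion of M continues from a row, the value
-- it passes on enters the next row no further right: the column condition bounds the counts of the
-- lower row by those of the upper one, and in case (IR2) entering further right would produce,
-- strictly between n₂ and n₁, the lowest entry of a run of consecutive entries of the lower row, an
-- ejectable value that (IR2) rules out. So the insertion of M ends weakly left of where M entered the
-- first row; moreover M is ejectable in the resulting tableau.
--
-- Now insert m and then m′ < m. In a row where the first insertion placed N and went on with N₊, all
-- entries left of N exceed N > N′, so the second insertion either stops strictly right of N, or
-- replaces an entry right of N (all of which are ≤ N₊) and passes on some N′₊ < N₊: passing on N₊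
-- itself would require (DR) with N₊ not ejectable, whereas the first insertion made N₊ ejectable in
-- the lower rows.

open import Defs
open import Data.Nat using (ℕ; zero; suc; _∸_; _<_; _≤_; _≟_; _≤?_; _<?_; _+_; z≤n; s≤s; s≤s⁻¹; z<s)
open import Data.Nat.Properties
open import Data.Bool using (true; false; _∧_)
open import Data.Bool.Properties using (∨-zeroʳ)
open import Data.List using ([]; _∷_; _++_; length; [_])
open import Data.List.Properties
  using (length-++; length-++-≤ˡ; length-++-sucʳ; ++-assoc; ∷-injectiveʳ)
open import Data.List.Membership.Propositional using (_∈_; _∉_)
open import Data.List.Membership.Propositional.Properties using (∈-++⁺ʳ; ∈-++⁻)
open import Data.List.Membership.DecPropositional _≟_ using (_∈?_)
open import Data.List.Relation.Unary.All as All using (All; []; _∷_)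
open import Data.List.Relation.Unary.All.Properties using (++⁺; ++⁻ˡ; ++⁻ʳ)
open import Data.List.Relation.Unary.AllPairs as AllPairs using (AllPairs; []; _∷_)
import Data.List.Relation.Unary.AllPairs.Properties as AllPairs
open import Data.List.Relation.Unary.Any using (here; there)
open import Data.List.Relation.Unary.Linked as Linked using ()
open import Data.List.Relation.Unary.Linked.Properties using (Linked⇒AllPairs)
open import Data.Maybe using (Maybe; just; nothing)
open import Data.Product using (∃-syntax; _×_; _,_; proj₁; proj₂; map₁; map₂)
open import Data.Sum using (_⊎_; inj₁; inj₂)
open import Relation.Nullary using (yes; no; contradiction)
open import Relation.Nullary.Decidable using (⌊_⌋)
open import Relation.Binary.PropositionalEquality
  using (_≡_; refl; sym; trans; cong; cong₂; subst; module ≡-Reasoning)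

-- Rows

∈⇒mem : ∀ {x R} → x ∈ R → mem x R ≡ true
∈⇒mem {x} {y ∷ R} (here refl) with x ≟ x
... | yes _ = refl
... | no x≢x = contradiction refl x≢x
∈⇒mem {x} {y ∷ R} (there x∈R) with x ≟ y
... | yes _ = refl
... | no _ = ∈⇒mem x∈R

mem⇒∈ : ∀ {x R} → mem x R ≡ true → x ∈ R
mem⇒∈ {x} {y ∷ R} mem≡true with x ≟ y
... | yes refl = here refl
... | no _ = there (mem⇒∈ mem≡true)

∉⇒¬mem : ∀ {x R} → x ∉ R → mem x R ≡ false
∉⇒¬mem {x} {R} x∉R with mem x R in eq
... | true = contradiction (mem⇒∈ eq) x∉R
... | false = refl

¬mem⇒∉ : ∀ {x R} → mem x R ≡ false → x ∉ R
¬mem⇒∉ ¬mem x∈R with trans (sym (∈⇒mem x∈R)) ¬mem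
... | ()

largestWith-just : ∀ p R {y} → largestWith p R ≡ just y → y ∈ R × p y ≡ true
largestWith-just p (x ∷ R) eq with largestWith p R in eqR | p x in px
largestWith-just p (x ∷ R) refl | nothing | true = here refl , px
largestWith-just p (x ∷ R) refl | just y | true with ⊔-sel x y
... | inj₁ x⊔y≡x rewrite x⊔y≡x = here refl , px
... | inj₂ x⊔y≡y rewrite x⊔y≡y = map₁ there (largestWith-just p R eqR)
largestWith-just p (x ∷ R) eq | _ | false = map₁ there (largestWith-just p R (trans eqR eq))

largestWith-nothing : ∀ p R → largestWith p R ≡ nothing → All (λ y → p y ≡ false) R
largestWith-nothing p [] _ = []
largestWith-nothing p (x ∷ R) eq with largestWith p R in eqR | p x in px
largestWith-nothing p (x ∷ R) refl | nothing | false = px ∷ largestWith-nothing p R eqR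

Decreasing : Row → Set
Decreasing = AllPairs _>_

data Pivot (N : ℕ) (R : Row) : Maybe ℕ → Set where
  none  : All (N <_) R → Pivot N R nothing
  pivot : ∀ A {n₁} B → R ≡ A ++ n₁ ∷ B → All (N <_) A → n₁ ≤ N → Pivot N R (just n₁)

largestWith-≤-pivot : ∀ N {R} → Decreasing R → Pivot N R (largestWith (λ x → ⌊ x ≤? N ⌋) R)
largestWith-≤-pivot N {[]} [] = none []
largestWith-≤-pivot N {x ∷ R} (x>R ∷ dec)
  with largestWith (λ x → ⌊ x ≤? N ⌋) R | largestWith-≤-pivot N dec | x ≤? N
... | _ | none _ | yes x≤N = pivot [] R refl [] x≤N
... | _ | pivot A {y} B refl _ _ | yes x≤N
  rewrite m≥n⇒m⊔n≡m (<⇒≤ (All.lookup x>R (∈-++⁺ʳ A {y ∷ B} (here refl)))) = pivot [] R refl [] x≤N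
... | _ | none N<R | no x≰N = none (≰⇒> x≰N ∷ N<R)
... | _ | pivot A B refl N<A n₁≤N | no x≰N = pivot (x ∷ A) B refl (≰⇒> x≰N ∷ N<A) n₁≤N

indexOf-++-∷ : ∀ A {x B} → x ∉ A → indexOf x (A ++ x ∷ B) ≡ length A
indexOf-++-∷ [] {x} _ with x ≟ x
... | yes _ = refl
... | no x≢x = contradiction refl x≢x
indexOf-++-∷ (a ∷ A) {x} x∉a∷A with x ≟ a
... | yes refl = contradiction (here refl) x∉a∷A
... | no _ = cong suc (indexOf-++-∷ A (λ x∈A → x∉a∷A (there x∈A)))

replaceAt-++-∷ : ∀ A {x v B} → replaceAt (length A) v (A ++ x ∷ B) ≡ A ++ v ∷ B
replaceAt-++-∷ [] = refl
replaceAt-++-∷ (a ∷ A) = cong (a ∷_) (replaceAt-++-∷ A)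

entryOr0-++-∷ : ∀ A {x B} → entryOr0 (suc (length A)) (A ++ x ∷ B) ≡ entryOr0 0 B
entryOr0-++-∷ [] {B = []} = refl
entryOr0-++-∷ [] {B = _ ∷ _} = refl
entryOr0-++-∷ (a ∷ A) = entryOr0-++-∷ A

entryOr0-zero-< : ∀ {n₁ B} → 0 < n₁ → All (_< n₁) B → entryOr0 0 B < n₁
entryOr0-zero-< {B = []} 0<n₁ _ = 0<n₁
entryOr0-zero-< {B = _ ∷ _} _ (b<n₁ ∷ _) = b<n₁

length-<-++-∷ : ∀ A {x : ℕ} {B} → length A < length (A ++ x ∷ B)
length-<-++-∷ A {x} {B} = ≤-trans (s≤s (length-++-≤ˡ A)) (≤-reflexive (sym (length-++-sucʳ A x B)))

All-++-∷-replace : ∀ {P : ℕ → Set} A {x v B} → All P (A ++ x ∷ B) → P v → All P (A ++ v ∷ B)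
All-++-∷-replace A PR Pv = ++⁺ (++⁻ˡ A PR) (Pv ∷ All.tail (++⁻ʳ A PR))

decreasing-++⁻ʳ : ∀ A {C} → Decreasing (A ++ C) → Decreasing C
decreasing-++⁻ʳ [] dec = dec
decreasing-++⁻ʳ (_ ∷ A) (_ ∷ dec) = decreasing-++⁻ʳ A dec

decreasing-replace : ∀ A {x v B} → Decreasing (A ++ x ∷ B) → All (v <_) A → x ≤ v →
                     Decreasing (A ++ v ∷ B)
decreasing-replace [] (x>B ∷ decB) [] x≤v = All.map (λ b<x → <-≤-trans b<x x≤v) x>B ∷ decB
decreasing-replace (a ∷ A) (a>rest ∷ dec) (v<a ∷ v<A) x≤v =
  All-++-∷-replace A a>rest v<a ∷ decreasing-replace A dec v<A x≤v

decreasing-snoc : ∀ {R v} → Decreasing R → All (v <_) R → Decreasing (R ++ [ v ])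
decreasing-snoc dec v<R = AllPairs.++⁺ dec ([] ∷ []) (All.map (_∷ []) v<R)

decreasing-≤-head : ∀ {B} → Decreasing B → All (_≤ entryOr0 0 B) B
decreasing-≤-head [] = []
decreasing-≤-head (b>B ∷ _) = ≤-refl ∷ All.map <⇒≤ b>B

lower-pivot-right : ∀ A {N B} A′ {n B′} → A ++ N ∷ B ≡ A′ ++ n ∷ B′ → All (N <_) A → n < N →
                    length A < length A′ × n ∈ B
lower-pivot-right [] [] refl _ n<N = contradiction n<N (<-irrefl refl)
lower-pivot-right [] (_ ∷ A″) refl _ _ = z<s , ∈-++⁺ʳ A″ (here refl)
lower-pivot-right (_ ∷ _) [] refl (N<n ∷ _) n<N = contradiction n<N (<-asym N<n)
lower-pivot-right (_ ∷ A) (_ ∷ A′) eq (_ ∷ N<A) n<N =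
  map₁ s≤s (lower-pivot-right A A′ (∷-injectiveʳ eq) N<A n<N)

pred∈-++-∷ : ∀ A {N B} → All (N <_) A → 0 < N → N ∸ 1 ∈ A ++ N ∷ B → N ∸ 1 ∈ B
pred∈-++-∷ A {suc M} N<A _ M∈R with ∈-++⁻ A M∈R
... | inj₁ M∈A = contradiction (All.lookup N<A M∈A) (<-asym (n<1+n M))
... | inj₂ (here M≡1+M) = contradiction (sym M≡1+M) 1+n≢n
... | inj₂ (there M∈B) = M∈B

pred∉-++-∷ : ∀ A {N B} → All (N <_) A → 0 < N → N ∸ 1 ∉ B → N ∸ 1 ∉ A ++ N ∷ B
pred∉-++-∷ A N<A 0<N pred∉B pred∈R = pred∉B (pred∈-++-∷ A N<A 0<N pred∈R)

pred∉-below : ∀ {n₁ N B} → All (_< n₁) B → n₁ < N → N ∸ 1 ∉ B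
pred∉-below {N = suc M} B<n₁ (s≤s n₁≤M) M∈B = <⇒≱ (All.lookup B<n₁ M∈B) n₁≤M

run-bottom : ∀ {t S} x → x ∈ S → t < x → t ∉ S → ∃[ z ] z ∈ S × t < z × z ≤ x × z ∸ 1 ∉ S
run-bottom {t} {S} (suc x) x+1∈S t<x+1 t∉S with x ∈? S
... | no x∉S = suc x , x+1∈S , t<x+1 , ≤-refl , x∉S
... | yes x∈S with m≤n⇒m<n∨m≡n (s≤s⁻¹ t<x+1)
...   | inj₂ refl = contradiction x∈S t∉S
...   | inj₁ t<x = map₂ (map₂ (map₂ (map₁ m≤n⇒m≤1+n))) (run-bottom x x∈S t<x t∉S)

-- Decreasing tableaux

firstRow-decreasing : ∀ {T} → IsDecreasingTableau T → Decreasing (firstRow T)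
firstRow-decreasing {[]} _ = []
firstRow-decreasing {_ ∷ _} P =
  Linked⇒AllPairs (λ b<a c<b → <-trans c<b b<a) (All.head (IsDecreasingTableau.rowsDecr P))

firstRow-positive : ∀ {T} → IsDecreasingTableau T → All (0 <_) (firstRow T)
firstRow-positive {[]} _ = []
firstRow-positive {_ ∷ _} P = All.head (IsDecreasingTableau.positive P)

firstRow-above : ∀ {R rest} → IsDecreasingTableau (R ∷ rest) → Above R (firstRow rest)
firstRow-above {rest = []} _ = []
firstRow-above {rest = _ ∷ _} P = Linked.head (IsDecreasingTableau.colsDecr P)

lowerRows : ∀ {R rest} → IsDecreasingTableau (R ∷ rest) → IsDecreasingTableau rest
lowerRows P = record
  { rowsNonempty = All.tail rowsNonempty
  ; positive     = All.tail positive
  ; rowsDecr     = All.tail rowsDecr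
  ; colsDecr     = Linked.tail colsDecr
  }
  where open IsDecreasingTableau P

suffix-decreasing : ∀ A {n₁ B rest} → IsDecreasingTableau ((A ++ n₁ ∷ B) ∷ rest) → Decreasing (n₁ ∷ B)
suffix-decreasing A P = decreasing-++⁻ʳ A (firstRow-decreasing P)

suffix-positive : ∀ A {n₁ B rest} → IsDecreasingTableau ((A ++ n₁ ∷ B) ∷ rest) → All (0 <_) (n₁ ∷ B)
suffix-positive A P = ++⁻ʳ A (firstRow-positive P)

ejectable-∷ : ∀ {z S} rest → z ∈ S → z ∸ 1 ∉ S ⊎ ejectable rest (z ∸ 1) ≡ true →
              ejectable (S ∷ rest) z ≡ true
ejectable-∷ rest z∈S pred-ok rewrite ∈⇒mem z∈S with pred-ok
... | inj₁ pred∉S rewrite ∉⇒¬mem pred∉S = refl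
... | inj₂ ej rewrite ej = ∨-zeroʳ _

ejectable-++-∷ : ∀ A {N B} rest → All (N <_) A → 0 < N → N ∸ 1 ∉ B →
                 ejectable ((A ++ N ∷ B) ∷ rest) N ≡ true
ejectable-++-∷ A rest N<A 0<N pred∉B =
  ejectable-∷ rest (∈-++⁺ʳ A (here refl)) (inj₁ (pred∉-++-∷ A N<A 0<N pred∉B))

-- Counting entries

count≥ : ℕ → Row → ℕ
count≥ v [] = 0
count≥ v (x ∷ S) with v ≤? x
... | yes _ = suc (count≥ v S)
... | no _ = count≥ v S

count≥-++ : ∀ v A C → count≥ v (A ++ C) ≡ count≥ v A + count≥ v C
count≥-++ v [] C = refl
count≥-++ v (x ∷ A) C with v ≤? x
... | yes _ = cong suc (count≥-++ v A C)
... | no _ = count≥-++ v A C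

count≥-all : ∀ {v S} → All (v ≤_) S → count≥ v S ≡ length S
count≥-all [] = refl
count≥-all {v} {x ∷ S} (v≤x ∷ v≤S) with v ≤? x
... | yes _ = cong suc (count≥-all v≤S)
... | no v≰x = contradiction v≤x v≰x

count≥-none : ∀ {v S} → All (_< v) S → count≥ v S ≡ 0
count≥-none [] = refl
count≥-none {v} {x ∷ S} (x<v ∷ S<v) with v ≤? x
... | yes v≤x = contradiction v≤x (<⇒≱ x<v)
... | no _ = count≥-none S<v

count≥-antitone : ∀ {v w} S → v ≤ w → count≥ w S ≤ count≥ v S
count≥-antitone [] _ = z≤n
count≥-antitone {v} {w} (x ∷ S) v≤w with w ≤? x | v ≤? x
... | yes _ | yes _ = s≤s (count≥-antitone S v≤w)
... | yes w≤x | no v≰x = contradiction (≤-trans v≤w w≤x) v≰x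
... | no _ | yes _ = m≤n⇒m≤1+n (count≥-antitone S v≤w)
... | no _ | no _ = count≥-antitone S v≤w

count≥-suc-< : ∀ {x S} → x ∈ S → count≥ (suc x) S < count≥ x S
count≥-suc-< {x} {_ ∷ S} (here refl) with suc x ≤? x | x ≤? x
... | yes x<x | _ = contradiction x<x (<-irrefl refl)
... | no _ | yes _ = s≤s (count≥-antitone S (n≤1+n x))
... | no _ | no x≰x = contradiction ≤-refl x≰x
count≥-suc-< {x} {y ∷ S} (there x∈S) with suc x ≤? y | x ≤? y
... | yes _ | yes _ = s≤s (count≥-suc-< x∈S)
... | yes x<y | no x≰y = contradiction (<⇒≤ x<y) x≰y
... | no _ | yes _ = m<n⇒m<1+n (count≥-suc-< x∈S)
... | no _ | no _ = count≥-suc-< x∈S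

count≥-witness : ∀ {v w} S → count≥ w S < count≥ v S → ∃[ x ] x ∈ S × v ≤ x × x < w
count≥-witness {v} {w} (x ∷ S) lt with w ≤? x | v ≤? x
... | no w≰x | yes v≤x = x , here refl , v≤x , ≰⇒> w≰x
... | yes _ | yes _ = map₂ (map₁ there) (count≥-witness S (s≤s⁻¹ lt))
... | yes _ | no _ = map₂ (map₁ there) (count≥-witness S (<⇒≤ lt))
... | no _ | no _ = map₂ (map₁ there) (count≥-witness S lt)

count≥-split : ∀ {v} A {C} → All (v ≤_) A → All (_< v) C → count≥ v (A ++ C) ≡ length A
count≥-split {v} A {C} v≤A C<v = begin
  count≥ v (A ++ C)         ≡⟨ count≥-++ v A C ⟩
  count≥ v A + count≥ v C   ≡⟨ cong₂ _+_ (count≥-all v≤A) (count≥-none C<v) ⟩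
  length A + 0              ≡⟨ +-identityʳ (length A) ⟩
  length A                  ∎
  where open ≡-Reasoning

count≥-gap : ∀ A {v n₁ B} → All (v ≤_) A → n₁ < v → All (_< n₁) B → count≥ v (A ++ n₁ ∷ B) ≡ length A
count≥-gap A v≤A n₁<v B<n₁ = count≥-split A v≤A (n₁<v ∷ All.map (λ b<n₁ → <-trans b<n₁ n₁<v) B<n₁)

count≥-pivot : ∀ {v} A {x B} → All (v ≤_) A → v ≤ x → All (_< v) B →
               count≥ v (A ++ x ∷ B) ≡ suc (length A)
count≥-pivot {v} A {x} {B} v≤A v≤x B<v = begin
  count≥ v (A ++ x ∷ B)         ≡⟨ cong (count≥ v) (sym (++-assoc A [ x ] B)) ⟩
  count≥ v ((A ++ [ x ]) ++ B)  ≡⟨ count≥-split (A ++ [ x ]) (++⁺ v≤A (v≤x ∷ [])) B<v ⟩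
  length (A ++ [ x ])           ≡⟨ length-++ A ⟩
  length A + 1                  ≡⟨ +-comm (length A) 1 ⟩
  suc (length A)                ∎
  where open ≡-Reasoning

count≥-below : ∀ {v R S} → Above R S → Decreasing S → count≥ v S ≤ count≥ (suc v) R
count≥-below [] _ = z≤n
count≥-below {v} {a ∷ R} {b ∷ S} (b<a ∷ R/S) (b>S ∷ decS) with v ≤? b | suc v ≤? a
... | yes _ | yes _ = s≤s (count≥-below R/S decS)
... | yes v≤b | no v≮a = contradiction (≤-<-trans v≤b b<a) v≮a
... | no v≰b | _ = ≤-trans (≤-reflexive (count≥-none S<v)) z≤n
  where S<v : All (_< v) S
        S<v = All.map (λ c<b → <-≤-trans c<b (≰⇒≥ v≰b)) b>S

count≥-next-row : ∀ {R rest v} → IsDecreasingTableau (R ∷ rest) →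
                  count≥ v (firstRow rest) ≤ count≥ (suc v) R
count≥-next-row P = count≥-below (firstRow-above P) (firstRow-decreasing (lowerRows P))

run-bottom-between : ∀ A {n₁ B S} → Above (A ++ n₁ ∷ B) S → Decreasing S →
  All (n₁ <_) A → Decreasing (n₁ ∷ B) → 0 < n₁ → length A < count≥ (suc (entryOr0 0 B)) S →
  ∃[ z ] z ∈ S × entryOr0 0 B < z × z < n₁ × z ∸ 1 ∉ S
run-bottom-between A {n₁} {B} {S} above decS n₁<A (B<n₁ ∷ decB) 0<n₁ many =
  let x , x∈S , n₂<x , x<n₁ = count≥-witness S few-from-n₁
      z , z∈S , n₂<z , z≤x , pred∉S = run-bottom x x∈S n₂<x n₂∉S
  in z , z∈S , n₂<z , ≤-<-trans z≤x x<n₁ , pred∉S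
  where
  open ≤-Reasoning
  n₂ : ℕ
  n₂ = entryOr0 0 B
  n₂<n₁ : n₂ < n₁
  n₂<n₁ = entryOr0-zero-< 0<n₁ B<n₁
  n₂∉S : n₂ ∉ S
  n₂∉S n₂∈S = <⇒≱ many (s≤s⁻¹ (begin-strict
    count≥ (suc n₂) S             <⟨ count≥-suc-< n₂∈S ⟩
    count≥ n₂ S                   ≤⟨ count≥-below above decS ⟩
    count≥ (suc n₂) (A ++ n₁ ∷ B) ≡⟨ count≥-pivot A (All.map (<-trans n₂<n₁) n₁<A) n₂<n₁
                                       (All.map s≤s (decreasing-≤-head decB)) ⟩
    suc (length A)                ∎))
  few-from-n₁ : count≥ n₁ S < count≥ (suc n₂) S
  few-from-n₁ = begin-strict
    count≥ n₁ S                   ≤⟨ count≥-below above decS ⟩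
    count≥ (suc n₁) (A ++ n₁ ∷ B) ≡⟨ count≥-gap A n₁<A (n<1+n n₁) B<n₁ ⟩
    length A                      <⟨ many ⟩
    count≥ (suc n₂) S             ∎

-- One iteration of the insertion

-- Row i is A ++ n₁ ∷ B and its entry n₁ is replaced by N; entryOr0 0 B is the paper's n₂ (0 when
-- n₁ ends the row). The constructors are the cases of the insertion that go on to row i+1 with the
-- value in the last index.
data Continue (n₁ : ℕ) (B : Row) (rest : Tableau) (N : ℕ) : ℕ → Set where
  D   : n₁ ≡ N → N ∸ 1 ∈ B → Continue n₁ B rest N (N ∸ 1)
  DR  : n₁ < N → ejectable rest n₁ ≡ false → N ∸ 1 ∉ B → Continue n₁ B rest N n₁
  IR1 : ∀ {y} → y ∈ firstRow rest → entryOr0 0 B < y → y < n₁ → N ∸ 1 ∉ B →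
        Continue n₁ B rest N y
  IR2 : 0 < entryOr0 0 B →
        (∀ {y} → y ∈ firstRow rest → entryOr0 0 B < y → y < n₁ → ejectable rest y ≡ false) →
        N ∸ 1 ∉ B → Continue n₁ B rest N (entryOr0 0 B)

data Iteration (i : ℕ) (R : Row) (rest : Tableau) (N : ℕ) : Result → Set where
  T1       : All (N <_) R → Iteration i R rest N ((R ++ [ N ]) ∷ rest , (i , suc (length R)) , 1)
  T2       : ∀ A {n₁} → R ≡ A ++ [ n₁ ] → All (N <_) A → n₁ ≤ N →
             Iteration i R rest N ((A ++ [ N ]) ∷ rest , (i , suc (length A)) , 0)
  continue : ∀ A {n₁} B {N₊} → R ≡ A ++ n₁ ∷ B → All (N <_) A → n₁ ≤ N →
             Continue n₁ B rest N N₊ →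
             Iteration i R rest N (consRow (A ++ N ∷ B) (ins (suc i) rest N₊))

between-true : ∀ {lo hi y b} → ⌊ lo <? y ⌋ ∧ ⌊ y <? hi ⌋ ∧ b ≡ true → lo < y × y < hi
between-true {lo} {hi} {y} _ with lo <? y | y <? hi
... | yes lo<y | yes y<hi = lo<y , y<hi

between-false : ∀ {lo hi y b} → lo < y → y < hi → ⌊ lo <? y ⌋ ∧ ⌊ y <? hi ⌋ ∧ b ≡ false → b ≡ false
between-false {lo} {hi} {y} lo<y y<hi e with lo <? y | y <? hi
... | yes _ | yes _ = e
... | no lo≮y | _ = contradiction lo<y lo≮y
... | yes _ | no y≮hi = contradiction y<hi y≮hi

iteration-IR : ∀ i A {n₁} B rest N → All (0 <_) (n₁ ∷ B) → All (N <_) A → n₁ ≤ N → N ∸ 1 ∉ B →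
  Iteration i (A ++ n₁ ∷ B) rest N
    (irStep (largestWith (λ y → ⌊ entryOr0 0 B <? y ⌋ ∧ ⌊ y <? n₁ ⌋ ∧ ejectable rest y) (firstRow rest))
            (entryOr0 0 B) (λ N₊ → consRow (A ++ N ∷ B) (ins (suc i) rest N₊))
            ((A ++ N ∷ B) ∷ rest , (i , suc (length A)) , 0))
iteration-IR i A {n₁} B rest N pos N<A n₁≤N pred∉B
  with largestWith (λ y → ⌊ entryOr0 0 B <? y ⌋ ∧ ⌊ y <? n₁ ⌋ ∧ ejectable rest y) (firstRow rest) in eq
... | just y with largestWith-just _ (firstRow rest) eq
...   | y∈S , py with between-true {entryOr0 0 B} {n₁} py
...     | n₂<y , y<n₁ = continue A B refl N<A n₁≤N (IR1 y∈S n₂<y y<n₁ pred∉B)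
iteration-IR i A [] rest N pos N<A n₁≤N pred∉B | nothing = T2 A refl N<A n₁≤N
iteration-IR i A (zero ∷ B) rest N (_ ∷ () ∷ _) N<A n₁≤N pred∉B | nothing
iteration-IR i A {n₁} (suc n₂ ∷ B) rest N pos N<A n₁≤N pred∉B | nothing =
  continue A (suc n₂ ∷ B) refl N<A n₁≤N (IR2 z<s none-ejectable pred∉B)
  where
  none-ejectable : ∀ {y} → y ∈ firstRow rest → suc n₂ < y → y < n₁ → ejectable rest y ≡ false
  none-ejectable y∈S n₂<y y<n₁ =
    between-false n₂<y y<n₁ (All.lookup (largestWith-nothing _ (firstRow rest) eq) y∈S)

iteration : ∀ i R rest N → Decreasing R → All (0 <_) R → Iteration i R rest N (ins i (R ∷ rest) N)
iteration i R rest N dec pos with largestWith (λ x → ⌊ x ≤? N ⌋) R | largestWith-≤-pivot N dec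
... | nothing | none N<R = T1 N<R
... | just n₁ | pivot A B refl N<A n₁≤N
  rewrite indexOf-++-∷ A {B = B} (λ n₁∈A → <⇒≱ (All.lookup N<A n₁∈A) n₁≤N)
        | replaceAt-++-∷ A {n₁} {N} {B} | entryOr0-++-∷ A {n₁} {B}
  with n₁ ≟ N
... | yes refl with mem (n₁ ∸ 1) (A ++ n₁ ∷ B) in pred∈?R
...   | true = continue A B refl N<A ≤-refl
                 (D refl (pred∈-++-∷ A N<A (All.head (++⁻ʳ A pos)) (mem⇒∈ pred∈?R)))
...   | false with n₁ <? n₁
...     | yes n₁<n₁ = contradiction n₁<n₁ (<-irrefl refl)
...     | no _ = iteration-IR i A B rest n₁ (++⁻ʳ A pos) N<A ≤-refl
                   (λ pred∈B → ¬mem⇒∉ pred∈?R (∈-++⁺ʳ A (there pred∈B)))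
iteration i _ rest N dec pos | just n₁ | pivot A B refl N<A n₁≤N | no n₁≢N with n₁ <? N
... | no n₁≮N = contradiction (≤∧≢⇒< n₁≤N n₁≢N) n₁≮N
... | yes n₁<N with ejectable rest n₁ in ej
...   | false = continue A B refl N<A n₁≤N (DR n₁<N ej (pred∉-below B<n₁ n₁<N))
  where B<n₁ : All (_< n₁) B
        B<n₁ = AllPairs.head (decreasing-++⁻ʳ A dec)
...   | true = iteration-IR i A B rest N (++⁻ʳ A pos) N<A n₁≤N (pred∉-below B<n₁ n₁<N)
  where B<n₁ : All (_< n₁) B
        B<n₁ = AllPairs.head (decreasing-++⁻ʳ A dec)

continue-positive : ∀ {n₁ B rest N N₊} → All (0 <_) (n₁ ∷ B) → Continue n₁ B rest N N₊ → 0 < N₊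
continue-positive (_ ∷ 0<B) (D _ pred∈B) = All.lookup 0<B pred∈B
continue-positive (0<n₁ ∷ _) (DR _ _ _) = 0<n₁
continue-positive _ (IR1 _ n₂<y _ _) = ≤-<-trans z≤n n₂<y
continue-positive _ (IR2 0<n₂ _ _) = 0<n₂

continue-suffix-≤ : ∀ {n₁ B rest N N₊} → Decreasing (n₁ ∷ B) → Continue n₁ B rest N N₊ → All (_≤ N₊) B
continue-suffix-≤ {zero} (B<0 ∷ _) (D refl _) = All.map (λ ()) B<0
continue-suffix-≤ {suc _} (B<n₁ ∷ _) (D refl _) = All.map s≤s⁻¹ B<n₁
continue-suffix-≤ (B<n₁ ∷ _) (DR _ _ _) = All.map <⇒≤ B<n₁
continue-suffix-≤ (_ ∷ decB) (IR1 _ n₂<y _ _) =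
  All.map (λ b≤n₂ → ≤-trans b≤n₂ (<⇒≤ n₂<y)) (decreasing-≤-head decB)
continue-suffix-≤ (_ ∷ decB) (IR2 _ _ _) = decreasing-≤-head decB

continue-passes-below : ∀ {n₁ B rest N N₊ K} → 0 < n₁ → All (_< n₁) B → n₁ ≤ K →
                        ejectable rest K ≡ true → Continue n₁ B rest N N₊ → N₊ < K
continue-passes-below {suc _} _ _ n₁≤K _ (D refl _) = n₁≤K
continue-passes-below _ _ n₁≤K ej-K (DR _ ¬ej-n₁ _) =
  ≤∧≢⇒< n₁≤K (λ { refl → contradiction (trans (sym ej-K) ¬ej-n₁) λ () })
continue-passes-below _ _ n₁≤K _ (IR1 _ _ y<n₁ _) = <-≤-trans y<n₁ n₁≤K
continue-passes-below 0<n₁ B<n₁ n₁≤K _ (IR2 _ _ _) = <-≤-trans (entryOr0-zero-< 0<n₁ B<n₁) n₁≤K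

continue-lands-left : ∀ A {n₁ B rest N N₊} → IsDecreasingTableau ((A ++ n₁ ∷ B) ∷ rest) →
  All (N <_) A → n₁ ≤ N → Continue n₁ B rest N N₊ → count≥ (suc N₊) (firstRow rest) ≤ length A
continue-lands-left A {rest = []} _ _ _ _ = z≤n
continue-lands-left A {n₁} {B} {S ∷ _} P N<A _ (D refl _) = begin
  count≥ (suc (n₁ ∸ 1)) S        ≡⟨ cong (λ v → count≥ v S) (m+[n∸m]≡n (All.head (suffix-positive A P))) ⟩
  count≥ n₁ S                    ≤⟨ count≥-next-row P ⟩
  count≥ (suc n₁) (A ++ n₁ ∷ B)  ≡⟨ count≥-gap A N<A ≤-refl (AllPairs.head (suffix-decreasing A P)) ⟩
  length A                       ∎
  where open ≤-Reasoning
continue-lands-left A {n₁} {B} {S ∷ _} P N<A _ (DR n₁<N _ _) = begin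
  count≥ (suc n₁) S                    ≤⟨ count≥-next-row P ⟩
  count≥ (suc (suc n₁)) (A ++ n₁ ∷ B)  ≡⟨ count≥-gap A (All.map (≤-trans (s≤s n₁<N)) N<A) (n≤1+n (suc n₁))
                                            (AllPairs.head (suffix-decreasing A P)) ⟩
  length A                             ∎
  where open ≤-Reasoning
continue-lands-left A {n₁} {B} {S ∷ _} P N<A n₁≤N (IR1 {y} y∈S n₂<y y<n₁ _) = s≤s⁻¹ (begin-strict
  count≥ (suc y) S              <⟨ count≥-suc-< y∈S ⟩
  count≥ y S                    ≤⟨ count≥-next-row P ⟩
  count≥ (suc y) (A ++ n₁ ∷ B)  ≡⟨ count≥-pivot A y<A y<n₁ B≤y ⟩
  suc (length A)                ∎)
  where open ≤-Reasoning
        y<A : All (suc y ≤_) A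
        y<A = All.map (λ N<a → <-trans y<n₁ (≤-<-trans n₁≤N N<a)) N<A
        B≤y : All (_< suc y) B
        B≤y = All.map (λ b≤n₂ → s≤s (≤-trans b≤n₂ (<⇒≤ n₂<y)))
                      (decreasing-≤-head (AllPairs.tail (suffix-decreasing A P)))
continue-lands-left A {n₁} {B} {S ∷ rest} P N<A n₁≤N (IR2 _ none-ejectable _)
  with count≥ (suc (entryOr0 0 B)) S ≤? length A
... | yes few = few
... | no many =
  let _ , z∈S , n₂<z , z<n₁ , pred∉S =
        run-bottom-between A (firstRow-above P) (firstRow-decreasing (lowerRows P))
          (All.map (≤-<-trans n₁≤N) N<A) (suffix-decreasing A P) (All.head (suffix-positive A P)) (≰⇒> many)
  in contradiction (trans (sym (ejectable-∷ rest z∈S (inj₁ pred∉S))) (none-ejectable z∈S n₂<z z<n₁))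
                   λ ()

-- Insertion paths

ins-column-≤ : ∀ j T M → IsDecreasingTableau T → resCol (ins j T M) ≤ suc (count≥ (suc M) (firstRow T))
ins-column-≤ j [] M _ = s≤s z≤n
ins-column-≤ j (R ∷ rest) M P
  with ins j (R ∷ rest) M | iteration j R rest M (firstRow-decreasing P) (firstRow-positive P)
... | _ | T1 M<R = s≤s (≤-reflexive (sym (count≥-all M<R)))
... | _ | T2 A refl M<A n₁≤M = s≤s (≤-reflexive (sym (count≥-split A M<A (s≤s n₁≤M ∷ []))))
... | _ | continue A {n₁} B {N₊} refl M<A n₁≤M step = begin
  resCol (ins (suc j) rest N₊)           ≤⟨ ins-column-≤ (suc j) rest N₊ (lowerRows P) ⟩
  suc (count≥ (suc N₊) (firstRow rest))  ≤⟨ s≤s (continue-lands-left A P M<A n₁≤M step) ⟩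
  suc (length A)                         ≡⟨ cong suc (count≥-gap A M<A (s≤s n₁≤M) B<n₁) ⟨
  suc (count≥ (suc M) (A ++ n₁ ∷ B))     ∎
  where open ≤-Reasoning
        B<n₁ : All (_< n₁) B
        B<n₁ = AllPairs.head (suffix-decreasing A P)

ins-ejectable : ∀ j T M → IsDecreasingTableau T → 0 < M → ejectable (resTab (ins j T M)) M ≡ true
ins-ejectable j [] M _ 0<M = ejectable-++-∷ [] {B = []} [] [] 0<M λ ()
ins-ejectable j (R ∷ rest) M P 0<M
  with ins j (R ∷ rest) M | iteration j R rest M (firstRow-decreasing P) (firstRow-positive P)
... | _ | T1 M<R = ejectable-++-∷ R rest M<R 0<M λ ()
... | _ | T2 A refl M<A _ = ejectable-++-∷ A rest M<A 0<M λ ()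
... | _ | continue A B {N₊} refl M<A _ step = lower step
  where
  rest′ : Tableau
  rest′ = resTab (ins (suc j) rest N₊)
  lower : ∀ {n₁} → Continue n₁ B rest M N₊ → ejectable ((A ++ M ∷ B) ∷ rest′) M ≡ true
  lower (D refl pred∈B) = ejectable-∷ rest′ (∈-++⁺ʳ A (here refl))
    (inj₂ (ins-ejectable (suc j) rest N₊ (lowerRows P) (All.lookup (All.tail (suffix-positive A P)) pred∈B)))
  lower (DR _ _ pred∉B) = ejectable-++-∷ A rest′ M<A 0<M pred∉B
  lower (IR1 _ _ _ pred∉B) = ejectable-++-∷ A rest′ M<A 0<M pred∉B
  lower (IR2 _ _ pred∉B) = ejectable-++-∷ A rest′ M<A 0<M pred∉B

ins-right-of-append : ∀ j A rest {N N′} → Decreasing (A ++ [ N ]) → All (0 <_) (A ++ [ N ]) →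
                      All (N <_) A → N′ < N → suc (length A) < resCol (ins j ((A ++ [ N ]) ∷ rest) N′)
ins-right-of-append j A rest {N} {N′} dec pos N<A N′<N =
  right (iteration j (A ++ [ N ]) rest N′ dec pos)
  where
  right : ∀ {res} → Iteration j (A ++ [ N ]) rest N′ res → suc (length A) < resCol res
  right (T1 _) = s≤s (length-<-++-∷ A)
  right (T2 A′ eq _ n′≤N′) = s≤s (proj₁ (lower-pivot-right A A′ eq N<A (≤-<-trans n′≤N′ N′<N)))
  right (continue A′ B′ eq _ n′≤N′ _)
    with () ← proj₂ (lower-pivot-right A A′ eq N<A (≤-<-trans n′≤N′ N′<N))

ins-columns-increase : ∀ j T N N′ → IsDecreasingTableau T → 0 < N → N′ < N →
                       resCol (ins j T N) < resCol (ins j (resTab (ins j T N)) N′)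
ins-columns-increase j [] N N′ _ 0<N N′<N = ins-right-of-append j [] [] ([] ∷ []) (0<N ∷ []) [] N′<N
ins-columns-increase j (R ∷ rest) N N′ P 0<N N′<N
  with ins j (R ∷ rest) N | iteration j R rest N (firstRow-decreasing P) (firstRow-positive P)
... | _ | T1 N<R = ins-right-of-append j R rest (decreasing-snoc (firstRow-decreasing P) N<R)
                     (++⁺ (firstRow-positive P) (0<N ∷ [])) N<R N′<N
... | _ | T2 A refl N<A n₁≤N =
  ins-right-of-append j A rest (decreasing-replace A (firstRow-decreasing P) N<A n₁≤N)
    (All-++-∷-replace A (firstRow-positive P) 0<N) N<A N′<N
... | _ | continue A {n₁} B {N₊} refl N<A n₁≤N step = later (iteration j R₁ rest′ N′ dec₁ pos₁)
  where
  R₁ : Row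
  R₁ = A ++ N ∷ B
  rest′ : Tableau
  rest′ = resTab (ins (suc j) rest N₊)
  dec₁ : Decreasing R₁
  dec₁ = decreasing-replace A (firstRow-decreasing P) N<A n₁≤N
  pos₁ : All (0 <_) R₁
  pos₁ = All-++-∷-replace A (firstRow-positive P) 0<N
  0<N₊ : 0 < N₊
  0<N₊ = continue-positive (suffix-positive A P) step
  first-column : resCol (ins (suc j) rest N₊) ≤ suc (length A)
  first-column = ≤-trans (ins-column-≤ (suc j) rest N₊ (lowerRows P))
                         (s≤s (continue-lands-left A P N<A n₁≤N step))
  later : ∀ {res} → Iteration j R₁ rest′ N′ res → resCol (ins (suc j) rest N₊) < resCol res
  later (T1 _) = s≤s (≤-trans first-column (length-<-++-∷ A))
  later (T2 A′ eq _ n′≤N′) =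
    s≤s (≤-trans first-column (proj₁ (lower-pivot-right A A′ eq N<A (≤-<-trans n′≤N′ N′<N))))
  later (continue A′ {n′} B′ {N′₊} eq _ n′≤N′ step′) =
    ins-columns-increase (suc j) rest N₊ N′₊ (lowerRows P) 0<N₊
      (continue-passes-below (All.head (++⁻ʳ A′ pos′)) (AllPairs.head (decreasing-++⁻ʳ A′ dec′)) n′≤N₊
        (ins-ejectable (suc j) rest N₊ (lowerRows P) 0<N₊) step′)
    where
    dec′ : Decreasing (A′ ++ n′ ∷ B′)
    dec′ = subst Decreasing eq dec₁
    pos′ : All (0 <_) (A′ ++ n′ ∷ B′)
    pos′ = subst (All (0 <_)) eq pos₁
    n′≤N₊ : n′ ≤ N₊
    n′≤N₊ = All.lookup (continue-suffix-≤ (suffix-decreasing A P) step)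
                       (proj₂ (lower-pivot-right A A′ eq N<A (≤-<-trans n′≤N′ N′<N)))

lemma5p6 : (P : Tableau) → IsDecreasingTableau P → (m m′ : ℕ) → 0 < m → 0 < m′ →
    m′ < m → resCol (Φ P m) < resCol (Φ (resTab (Φ P m)) m′)
lemma5p6 P isDec m m′ 0<m _ m′<m = ins-columns-increase 1 P m m′ isDec 0<m m′<m
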